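{- There is no edge-transitive Woolly Hat graph of girth $3$. Consequently, if $\mathrm{WH}_n(a,b,c,d)$ is edge-transitive, then $b$, $c$ and $d$ are all nonzero.
   Context: For an integer $n\ge 3$ and $a,b,c,d\in\mathbb{Z}_n$ with $2a\neq 0$, $b,c,d$ pairwise distinct, and such that no prime divides $n$ together with (integer representatives of) all of $a,b,c,d$, the Woolly Hat graph $\mathrm{WH}_n(a,b,c,d)$ is the graph with vertex set $\{A_i,B_i,C_i : i\in\mathbb{Z}_n\}$ with adjacencies, for each $i\in\mathbb{Z}_n$ (subscripts mod $n$): $A_i\sim A_{i-a},A_{i+a},B_i,C_i$; $B_i\sim A_i,C_{i+b},C_{i+c},C_{i+d}$; $C_i\sim A_i,B_{i-b},B_{i-c},B_{i-d}$. -}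

module Defs where

open import Data.Nat using (ℕ; zero; suc; _+_; _∸_; _≤_; NonZero)
open import Data.Nat.DivMod using (_%_; m%n<n)
open import Data.Nat.Divisibility using (_∣_)
open import Data.Nat.Primality using (Prime)
open import Data.Fin using (Fin; toℕ; fromℕ<)
open import Data.Product using (_×_; Σ; ∃; _,_)
open import Data.Sum using (_⊎_)
open import Data.Empty using (⊥)
open import Relation.Nullary using (¬_)
open import Relation.Binary.PropositionalEquality using (_≡_; _≢_)
open import Function.Bundles using (_↔_; Inverse; _⇔_)

module ZMod (n : ℕ) ⦃ _ : NonZero n ⦄ where

  fromℕ : ℕ → Fin n
  fromℕ m = fromℕ< (m%n<n m n)

  𝟘 : Fin n
  𝟘 = fromℕ 0

  _⊕_ : Fin n → Fin n → Fin n
  i ⊕ j = fromℕ (toℕ i + toℕ j)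

  ⊖_ : Fin n → Fin n
  ⊖ i = fromℕ (n ∸ toℕ i)

  _⊖_ : Fin n → Fin n → Fin n
  i ⊖ j = i ⊕ (⊖ j)

  infixl 6 _⊕_ _⊖_

data WHVertex (n : ℕ) : Set where
  A B C : Fin n → WHVertex n

WHParams : (n : ℕ) ⦃ _ : NonZero n ⦄ → (a b c d : Fin n) → Set
WHParams n a b c d =
  3 ≤ n × (a ⊕ a ≢ 𝟘) × (b ≢ c) × (b ≢ d) × (c ≢ d) ×
  (∀ p → Prime p → p ∣ n → p ∣ toℕ a → p ∣ toℕ b → p ∣ toℕ c → p ∣ toℕ d → ⊥)
  where open ZMod n

WHAdj : (n : ℕ) ⦃ _ : NonZero n ⦄ → (a b c d : Fin n) →
        WHVertex n → WHVertex n → Set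
WHAdj n a b c d (A i) (A j) = j ≡ i ⊖ a ⊎ j ≡ i ⊕ a  where open ZMod n
WHAdj n a b c d (A i) (B j) = j ≡ i
WHAdj n a b c d (A i) (C j) = j ≡ i
WHAdj n a b c d (B i) (A j) = j ≡ i
WHAdj n a b c d (B i) (B j) = ⊥
WHAdj n a b c d (B i) (C j) = j ≡ i ⊕ b ⊎ j ≡ i ⊕ c ⊎ j ≡ i ⊕ d  where open ZMod n
WHAdj n a b c d (C i) (A j) = j ≡ i
WHAdj n a b c d (C i) (B j) = j ≡ i ⊖ b ⊎ j ≡ i ⊖ c ⊎ j ≡ i ⊖ d  where open ZMod n
WHAdj n a b c d (C i) (C j) = ⊥

record Automorphism {V : Set} (E : V → V → Set) : Set where
  field
    perm     : V ↔ V
    preserve : ∀ u v → E u v ⇔ E (Inverse.to perm u) (Inverse.to perm v)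

EdgeTransitive : {V : Set} → (V → V → Set) → Set
EdgeTransitive {V} E =
  ∀ u v x y → E u v → E x y →
  Σ (Automorphism E) λ σ →
    let f = Inverse.to (Automorphism.perm σ) in
    (f u ≡ x × f v ≡ y) ⊎ (f u ≡ y × f v ≡ x)

HasTriangle : {V : Set} → (V → V → Set) → Set
HasTriangle {V} E =
  Σ V λ u → Σ V λ v → Σ V λ w →
    u ≢ v × v ≢ w × u ≢ w × E u v × E v w × E w u

-- An automorphism carrying an edge of a triangle onto the edge B₀C_x carries the
-- third vertex to a common neighbour of B₀ and C_x.  The only possible common
-- neighbour is an A-vertex, which forces x = 0; and since b ≠ c one of them is
-- nonzero, giving such an edge.  Conversely b, c or d being zero makes A₀B₀C₀
-- a triangle.

module Submission where

open import Defs
open import Data.Nat using (ℕ; NonZero; suc; _%_)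
open import Data.Nat.DivMod using (m<n⇒m%n≡m)
open import Data.Fin using (Fin; toℕ; _≟_)
open import Data.Fin.Properties using (toℕ-fromℕ<; toℕ-injective; toℕ<n)
open import Data.Product using (_×_; _,_; ∃)
open import Data.Sum using (_⊎_; inj₁; inj₂)
open import Relation.Nullary using (¬_; yes; no)
open import Relation.Binary.PropositionalEquality
open import Function.Bundles using (Inverse; Equivalence)

⊕-identityˡ : (n : ℕ) ⦃ _ : NonZero n ⦄ (x : Fin n) → ZMod._⊕_ n (ZMod.𝟘 n) x ≡ x
⊕-identityˡ (suc k) x = toℕ-injective (begin
  toℕ (ZMod.fromℕ (suc k) (toℕ x)) ≡⟨ toℕ-fromℕ< _ ⟩
  toℕ x % suc k                    ≡⟨ m<n⇒m%n≡m (toℕ<n x) ⟩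
  toℕ x                            ∎)
  where open ≡-Reasoning

module _ {V : Set} {E : V → V → Set} where

  automorphism-preserves : (σ : Automorphism E) →
    let f = Inverse.to (Automorphism.perm σ) in ∀ {u v} → E u v → E (f u) (f v)
  automorphism-preserves σ {u} {v} = Equivalence.to (Automorphism.preserve σ u v)

  edge-in-triangle : EdgeTransitive E → HasTriangle E → ∀ {x y} → E x y →
    ∃ λ z → (E y z × E z x) ⊎ (E x z × E z y)
  edge-in-triangle et (u , v , w , _ , _ , _ , uv , vw , wu) {x} {y} xy
    with et u v x y uv xy
  ... | σ , inj₁ (refl , refl) = f w , inj₁ (adj vw , adj wu)
    where f = Inverse.to (Automorphism.perm σ)
          adj = automorphism-preserves σ
  ... | σ , inj₂ (refl , refl) = f w , inj₂ (adj vw , adj wu)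
    where f = Inverse.to (Automorphism.perm σ)
          adj = automorphism-preserves σ

module _ (n : ℕ) ⦃ _ : NonZero n ⦄ (a b c d : Fin n) where
  open ZMod n
  private E = WHAdj n a b c d

  B𝟘-C-adjacent : ∀ {x} → x ≡ b ⊎ x ≡ c ⊎ x ≡ d → E (B 𝟘) (C x)
  B𝟘-C-adjacent {x} x∈bcd rewrite ⊕-identityˡ n b | ⊕-identityˡ n c | ⊕-identityˡ n d
    = x∈bcd

  common-neighbour-B𝟘-C⇒𝟘 : ∀ {x} z → (E (C x) z × E z (B 𝟘)) ⊎ (E (B 𝟘) z × E z (C x)) →
    x ≡ 𝟘
  common-neighbour-B𝟘-C⇒𝟘 (A j) (inj₁ (j≡x , 𝟘≡j)) = sym (trans 𝟘≡j j≡x)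
  common-neighbour-B𝟘-C⇒𝟘 (A j) (inj₂ (j≡𝟘 , x≡j)) = trans x≡j j≡𝟘
  common-neighbour-B𝟘-C⇒𝟘 (B j) (inj₁ (_ , ()))
  common-neighbour-B𝟘-C⇒𝟘 (B j) (inj₂ (() , _))
  common-neighbour-B𝟘-C⇒𝟘 (C j) (inj₁ (() , _))
  common-neighbour-B𝟘-C⇒𝟘 (C j) (inj₂ (_ , ()))

  B𝟘-C𝟘-triangle : E (B 𝟘) (C 𝟘) → HasTriangle E
  B𝟘-C𝟘-triangle B𝟘C𝟘 = A 𝟘 , B 𝟘 , C 𝟘 , (λ ()) , (λ ()) , (λ ()) , refl , B𝟘C𝟘 , refl

  nonzero-B𝟘-C-edge : b ≢ c → ∃ λ x → x ≢ 𝟘 × E (B 𝟘) (C x)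
  nonzero-B𝟘-C-edge b≢c with b ≟ 𝟘
  ... | no b≢𝟘 = b , b≢𝟘 , B𝟘-C-adjacent (inj₁ refl)
  ... | yes refl = c , (λ c≡𝟘 → b≢c (sym c≡𝟘)) , B𝟘-C-adjacent (inj₂ (inj₁ refl))

  triangle-free-if-edge-transitive : b ≢ c → ¬ (EdgeTransitive E × HasTriangle E)
  triangle-free-if-edge-transitive b≢c (et , tri) with nonzero-B𝟘-C-edge b≢c
  ... | x , x≢𝟘 , edge with edge-in-triangle et tri edge
  ...   | z , common = x≢𝟘 (common-neighbour-B𝟘-C⇒𝟘 z common)

lemma3p3 : (n : ℕ) ⦃ _ : NonZero n ⦄ (a b c d : Fin n) → WHParams n a b c d →
    (¬ (EdgeTransitive (WHAdj n a b c d) × HasTriangle (WHAdj n a b c d)))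
    × (EdgeTransitive (WHAdj n a b c d) →
    (b ≢ ZMod.𝟘 n) × (c ≢ ZMod.𝟘 n) × (d ≢ ZMod.𝟘 n))
lemma3p3 n a b c d (_ , _ , b≢c , _ , _ , _) =
  no-triangle , λ et → nonzero et (inj₁ refl) , nonzero et (inj₂ (inj₁ refl))
                     , nonzero et (inj₂ (inj₂ refl))
  where
  no-triangle : ¬ (EdgeTransitive (WHAdj n a b c d) × HasTriangle (WHAdj n a b c d))
  no-triangle = triangle-free-if-edge-transitive n a b c d b≢c

  nonzero : EdgeTransitive (WHAdj n a b c d) → ∀ {x} → x ≡ b ⊎ x ≡ c ⊎ x ≡ d →
    x ≢ ZMod.𝟘 n
  nonzero et x∈bcd refl =
    no-triangle (et , B𝟘-C𝟘-triangle n a b c d (B𝟘-C-adjacent n a b c d x∈bcd))
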